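{- Let $Q$ be a delta operator with umbral operator $\phi$. Then \[ \phi=Q'\,(D/Q)^{\hat xD+1}, \] and moreover $\phi=\hat x(D/Q)^{\hat xD+1}\hat x^{ -1}$, in the sense that $\phi x^n=\hat x\,(D/Q)^{\hat xD+1}x^{n-1}$ for every $n\ge1$.
   Context: $\mathbb K$ is a field of characteristic zero; operators are linear maps on $\mathbb K[x]$; $\hat x$ is multiplication by $x$, $D=d/dx$. Shift-invariant operators (commuting with all shifts $f(x)\mapsto f(x+a)$) are formal power series in $D$. A delta operator is a shift-invariant $Q$ with $Qx$ a nonzero constant; $Q=DP$ with $P$ an invertible shift-invariant operator, and $D/Q\defeq P^{ -1}$. Its umbral operator $\phi$ is given by $\phi x^n=\phi_n(x)$ where $(\phi_n)$ is the unique polynomial sequence with $\deg\phi_n=n$, $\phi_0=1$, $\phi_n(0)=0$ ($n\ge1$), $Q\phi_n=n\phi_{n-1}$. $Q'=Q\hat x-\hat xQ$ is the Pincherle derivative. Generalized exponentiation of operators: $U^V\defeq\sum_{m\ge0}(U-1)^m\binom{V}{m}$ with $\binom{V}{m}=V(V-1)\cdots(V-m+1)/m!$ (note the order: powers of $U-1$ on the left); applied to $x^n$, $\binom{\hat xD+1}{m}x^n=\binom{n+1}{m}x^n$, so the sum is finite. -}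

module Defs where

open import Level using (_⊔_) renaming (suc to lsuc)
open import Data.Nat using (ℕ; zero; suc; _<_)
open import Data.Nat.Combinatorics using (_C_)
open import Data.List using (List; []; _∷_; length; replicate; _++_)
open import Data.Product using (Σ; _×_; _,_)
open import Relation.Nullary using (¬_)
open import Relation.Binary.PropositionalEquality using (_≡_)
open import Algebra.Bundles using (CommutativeRing)
import Algebra.Definitions.RawMonoid as RM

record Field0 c ℓ : Set (lsuc (c ⊔ ℓ)) where
  field
    commRing : CommutativeRing c ℓ
  open CommutativeRing commRing public
  open RM +-rawMonoid public using () renaming (_×_ to _·ℕ_)
  field
    nontrivial : ¬ (1# ≈ 0#)
    inverse    : ∀ a → ¬ (a ≈ 0#) → Σ Carrier (λ b → a * b ≈ 1#)
    charZero   : ∀ n → n ·ℕ 1# ≈ 0# → n ≡ 0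

-- Polynomials in K[x] as coefficient lists (constant term first), compared up
-- to trailing zeros; operators are functions on these lists.
module Poly {c ℓ} (F : Field0 c ℓ) where
  open Field0 F using (Carrier; _≈_; _+_; _*_; -_; _-_; 0#; 1#; _·ℕ_)

  Pol : Set c
  Pol = List Carrier

  coeff : Pol → ℕ → Carrier
  coeff []       _       = 0#
  coeff (a ∷ _)  zero    = a
  coeff (_ ∷ as) (suc i) = coeff as i

  infix 4 _≋_
  _≋_ : Pol → Pol → Set ℓ
  p ≋ q = ∀ i → coeff p i ≈ coeff q i

  infixl 6 _⊕_
  _⊕_ : Pol → Pol → Pol
  []       ⊕ q        = q
  p        ⊕ []       = p
  (a ∷ as) ⊕ (b ∷ bs) = (a + b) ∷ (as ⊕ bs)

  scale : Carrier → Pol → Pol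
  scale k []       = []
  scale k (a ∷ as) = (k * a) ∷ scale k as

  neg : Pol → Pol
  neg p = scale (- 1#) p

  const : Carrier → Pol
  const a = a ∷ []

  monomial : ℕ → Pol
  monomial n = replicate n 0# ++ (1# ∷ [])

  X̂ : Pol → Pol
  X̂ p = 0# ∷ p

  private
    derivAux : ℕ → Pol → Pol
    derivAux k []       = []
    derivAux k (a ∷ as) = (k ·ℕ a) ∷ derivAux (suc k) as

  D : Pol → Pol
  D []       = []
  D (_ ∷ as) = derivAux 1 as

  Dpow : ℕ → Pol → Pol
  Dpow zero    p = p
  Dpow (suc k) p = D (Dpow k p)

  sumPol : ℕ → (ℕ → Pol) → Pol
  sumPol zero    f = []
  sumPol (suc n) f = sumPol n f ⊕ f n

  sumK : ℕ → (ℕ → Carrier) → Carrier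
  sumK zero    f = 0#
  sumK (suc n) f = sumK n f + f n

  -- Formal power series Σ_k s_k D^k, acting on K[x] (finite sum on each polynomial:
  -- D^k p = 0 for k ≥ length p).
  PS : Set c
  PS = ℕ → Carrier

  applyPS : PS → Pol → Pol
  applyPS s p = sumPol (length p) (λ k → scale (s k) (Dpow k p))

  pincherle : (Pol → Pol) → Pol → Pol
  pincherle Q p = Q (X̂ p) ⊕ neg (X̂ (Q p))

  -- product of power series (composition of shift-invariant operators)
  _⋆_ : PS → PS → PS
  (s ⋆ t) n = sumK (suc n) (λ i → s i * t (n Data.Nat.∸ i))

  onePS : PS
  onePS zero    = 1#
  onePS (suc _) = 0#

  minusOne : PS → PS
  minusOne s zero    = s zero - 1#
  minusOne s (suc k) = s (suc k)

  powOp : ℕ → (Pol → Pol) → Pol → Pol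
  powOp zero    A p = p
  powOp (suc m) A p = A (powOp m A p)

  -- binom(x̂D+1, m): acts on x^i as multiplication by binom(i+1, m)
  binomOp : ℕ → Pol → Pol
  binomOp m p = go 0 p
    where
    go : ℕ → Pol → Pol
    go i []       = []
    go i (a ∷ as) = (((suc i) C m) ·ℕ a) ∷ go (suc i) as

  -- generalised exponentiation  U^(x̂D+1) = Σ_m (U−1)^m binom(x̂D+1, m);
  -- on a polynomial of length L the terms with m > L vanish.
  expXD1 : PS → Pol → Pol
  expXD1 U p = sumPol (suc (length p)) (λ m → powOp m (applyPS (minusOne U)) (binomOp m p))

  linExt : (ℕ → Pol) → Pol → Pol
  linExt φ p = sumPol (length p) (λ i → scale (coeff p i) (φ i))

  HasDegree : Pol → ℕ → Set ℓ
  HasDegree p n = ¬ (coeff p n ≈ 0#) × (∀ i → n < i → coeff p i ≈ 0#)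

  IsDelta : PS → Set (c ⊔ ℓ)
  IsDelta q = Σ Carrier (λ a → ¬ (a ≈ 0#) × (applyPS q (monomial 1) ≋ const a))

  -- P with Q = D P  (P = Σ q_{k+1} D^k)
  divD : PS → PS
  divD q k = q (suc k)

  -- r represents D/Q = P⁻¹
  IsDoverQ : PS → PS → Set ℓ
  IsDoverQ q r = ∀ n → (divD q ⋆ r) n ≈ onePS n

  -- φ is the basic sequence of Q (umbral operator φ x^n = φ n)
  IsBasicSeq : PS → (ℕ → Pol) → Set ℓ
  IsBasicSeq q φ =
    (∀ n → HasDegree (φ n) n) ×
    (φ 0 ≋ const 1#) ×
    (∀ n → coeff (φ (suc n)) 0 ≈ 0#) ×
    (∀ n → applyPS q (φ (suc n)) ≋ scale (suc n ·ℕ 1#) (φ n))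

{-# OPTIONS --safe #-}

-- A shift-invariant operator Σ sₖ Dᵏ acts on a polynomial through finitely many terms, so such
-- operators compose as power series in D: P = Q/D and R = D/Q are mutually inverse, and the
-- Pincherle derivative of Σ sₖ Dᵏ is Σ k sₖ Dᵏ⁻¹. On xⁿ the operator x̂D + 1 acts as n + 1, so the
-- binomial theorem collapses R^(x̂D+1) xⁿ to Rⁿ⁺¹ xⁿ. Differentiating P R = 1 gives
-- (Rⁿ)′ = −n P′ Rⁿ⁺¹, and together with Q′ = P + D P′ this yields Q′ Rⁿ⁺¹ xⁿ = ψₙ, where ψ₀ = 1 and
-- ψₙ = x̂ Rⁿ xⁿ⁻¹ for n ≥ 1. These satisfy Q ψₙ = n ψₙ₋₁ and ψₙ(0) = 0 for n ≥ 1; since Q d = 0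
-- and d(0) = 0 force d = 0, they are the basic sequence φₙ, and both formulas follow by linearity.

module Submission where

open import Defs
open import Level using (Level; _⊔_)
open import Data.Nat as ℕ using (ℕ; zero; suc; _≤_; _<_; z≤n; s≤s; _∸_; _≤′_; ≤′-refl; ≤′-step)
import Data.Nat.Properties as ℕₚ
open import Data.Nat.Combinatorics using (_C_; k>n⇒nCk≡0; nCk+nC[k+1]≡[n+1]C[k+1])
open import Data.List using ([]; _∷_; length)
open import Data.Product using (_×_; _,_)
open import Function using (_∘_)
open import Relation.Nullary using (¬_; yes; no)
open import Relation.Binary.PropositionalEquality as ≡ using (_≡_)
open import Algebra.Bundles using (AbelianGroup)
import Relation.Binary.Reasoning.Setoid as SetoidReasoning

module Umbral {c ℓ} (F : Field0 c ℓ) where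
  open Field0 F
  open Poly F
  open import Algebra.Properties.Ring ring using (-1*x≈-x; -0#≈0#)
  open import Algebra.Properties.Semiring.Mult semiring using (×-homo-+; ×-assoc-*; ×-congʳ)
  open import Algebra.Solver.Ring.NaturalCoefficients.Default commutativeSemiring
    using (solve; _:=_; _:+_; _:*_)

  fromℕ : ℕ → Carrier
  fromℕ n = n ·ℕ 1#

  ·ℕ≈fromℕ* : ∀ n x → n ·ℕ x ≈ fromℕ n * x
  ·ℕ≈fromℕ* n x = sym (trans (×-assoc-* n 1# x) (×-congʳ n (*-identityˡ x)))

  fromℕ-cong : ∀ {m n} → m ≡ n → fromℕ m ≈ fromℕ n
  fromℕ-cong ≡.refl = refl

  fromℕ-1 : fromℕ 1 ≈ 1#
  fromℕ-1 = +-identityʳ 1#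

  fromℕ-suc≉0 : ∀ n → ¬ fromℕ (suc n) ≈ 0#
  fromℕ-suc≉0 n eq with charZero (suc n) eq
  ... | ()

  *-cancel-≉0 : ∀ {a x} → ¬ a ≈ 0# → a * x ≈ 0# → x ≈ 0#
  *-cancel-≉0 {a} {x} a≉0 ax≈0 with inverse a a≉0
  ... | b , ab≈1 = begin
    x              ≈⟨ sym (*-identityˡ x) ⟩
    1# * x         ≈⟨ *-cong (trans (sym ab≈1) (*-comm a b)) refl ⟩
    (b * a) * x    ≈⟨ *-assoc b a x ⟩
    b * (a * x)    ≈⟨ *-cong refl ax≈0 ⟩
    b * 0#         ≈⟨ zeroʳ b ⟩
    0#             ∎
    where open SetoidReasoning setoid

  -- Polynomials up to coefficientwise equality

  coeff-⊕ : ∀ p q i → coeff (p ⊕ q) i ≈ coeff p i + coeff q i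
  coeff-⊕ []      q       i       = sym (+-identityˡ _)
  coeff-⊕ (a ∷ p) []      i       = sym (+-identityʳ _)
  coeff-⊕ (a ∷ p) (b ∷ q) zero    = refl
  coeff-⊕ (a ∷ p) (b ∷ q) (suc i) = coeff-⊕ p q i

  coeff-scale : ∀ a p i → coeff (scale a p) i ≈ a * coeff p i
  coeff-scale a []      i       = sym (zeroʳ a)
  coeff-scale a (b ∷ p) zero    = refl
  coeff-scale a (b ∷ p) (suc i) = coeff-scale a p i

  coeff-neg : ∀ p i → coeff (neg p) i ≈ - coeff p i
  coeff-neg p i = trans (coeff-scale (- 1#) p i) (-1*x≈-x _)

  -- A record copy of _≋_: unlike the Π-type, it lets Agda infer both polynomials from a proof.
  infix 4 _≅_
  record _≅_ (p q : Pol) : Set ℓ where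
    constructor coeffwise
    field coeff-≈ : ∀ i → coeff p i ≈ coeff q i
  open _≅_ public

  ≅-refl : ∀ {p} → p ≅ p
  ≅-refl = coeffwise λ _ → refl

  ≡⇒≅ : ∀ {p q} → p ≡ q → p ≅ q
  ≡⇒≅ ≡.refl = ≅-refl

  ≅-sym : ∀ {p q} → p ≅ q → q ≅ p
  ≅-sym (coeffwise e) = coeffwise λ i → sym (e i)

  ≅-trans : ∀ {p q r} → p ≅ q → q ≅ r → p ≅ r
  ≅-trans (coeffwise e) (coeffwise f) = coeffwise λ i → trans (e i) (f i)

  ⊕-cong : ∀ {p p′ q q′} → p ≅ p′ → q ≅ q′ → p ⊕ q ≅ p′ ⊕ q′
  ⊕-cong {p} {p′} {q} {q′} (coeffwise e) (coeffwise f) = coeffwise λ i →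
    trans (coeff-⊕ p q i) (trans (+-cong (e i) (f i)) (sym (coeff-⊕ p′ q′ i)))

  ⊕-congˡ : ∀ p {q q′} → q ≅ q′ → p ⊕ q ≅ p ⊕ q′
  ⊕-congˡ p = ⊕-cong (≅-refl {p})

  ⊕-congʳ : ∀ {p p′} q → p ≅ p′ → p ⊕ q ≅ p′ ⊕ q
  ⊕-congʳ q e = ⊕-cong e (≅-refl {q})

  ⊕-assoc : ∀ p q r → (p ⊕ q) ⊕ r ≅ p ⊕ (q ⊕ r)
  ⊕-assoc p q r = coeffwise λ i → begin
    coeff ((p ⊕ q) ⊕ r) i                  ≈⟨ trans (coeff-⊕ (p ⊕ q) r i) (+-cong (coeff-⊕ p q i) refl) ⟩
    (coeff p i + coeff q i) + coeff r i    ≈⟨ +-assoc _ _ _ ⟩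
    coeff p i + (coeff q i + coeff r i)    ≈⟨ sym (trans (coeff-⊕ p (q ⊕ r) i) (+-cong refl (coeff-⊕ q r i))) ⟩
    coeff (p ⊕ (q ⊕ r)) i                  ∎
    where open SetoidReasoning setoid

  ⊕-comm : ∀ p q → p ⊕ q ≅ q ⊕ p
  ⊕-comm p q = coeffwise λ i → trans (coeff-⊕ p q i) (trans (+-comm _ _) (sym (coeff-⊕ q p i)))

  ⊕-identityʳ : ∀ p → p ⊕ [] ≅ p
  ⊕-identityʳ p = coeffwise λ i → trans (coeff-⊕ p [] i) (+-identityʳ _)

  ⊕-inverseʳ : ∀ p → p ⊕ neg p ≅ []
  ⊕-inverseʳ p = coeffwise λ i → trans (coeff-⊕ p (neg p) i) (trans (+-cong refl (coeff-neg p i)) (-‿inverseʳ _))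

  scale-cong : ∀ {a b p q} → a ≈ b → p ≅ q → scale a p ≅ scale b q
  scale-cong {a} {b} {p} {q} a≈b (coeffwise e) = coeffwise λ i →
    trans (coeff-scale a p i) (trans (*-cong a≈b (e i)) (sym (coeff-scale b q i)))

  neg-cong : ∀ {p q} → p ≅ q → neg p ≅ neg q
  neg-cong = scale-cong refl

  polAbelianGroup : AbelianGroup c ℓ
  polAbelianGroup = record
    { Carrier = Pol ; _≈_ = _≅_ ; _∙_ = _⊕_ ; ε = [] ; _⁻¹ = neg
    ; isAbelianGroup = record
      { isGroup = record
        { isMonoid = record
          { isSemigroup = record
            { isMagma = record
              { isEquivalence = record { refl = ≅-refl ; sym = ≅-sym ; trans = ≅-trans }
              ; ∙-cong = ⊕-cong }
            ; assoc = ⊕-assoc }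
          ; identity = (λ _ → ≅-refl) , ⊕-identityʳ }
        ; inverse = (λ p → ≅-trans (⊕-comm (neg p) p) (⊕-inverseʳ p)) , ⊕-inverseʳ
        ; ⁻¹-cong = neg-cong }
      ; comm = ⊕-comm } }

  open AbelianGroup polAbelianGroup using (inverseˡ) renaming (setoid to polSetoid)
  open import Algebra.Properties.AbelianGroup polAbelianGroup
    using (xyx⁻¹≈y; inverseˡ-unique; ⁻¹-∙-comm; x∙y⁻¹≈ε⇒x≈y)
  module ≅-Reasoning = SetoidReasoning polSetoid

  ⊕-telescope : ∀ u v w → (u ⊕ neg v) ⊕ (v ⊕ neg w) ≅ u ⊕ neg w
  ⊕-telescope u v w = begin
    (u ⊕ neg v) ⊕ (v ⊕ neg w)  ≈⟨ ⊕-assoc u (neg v) _ ⟩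
    u ⊕ (neg v ⊕ (v ⊕ neg w))  ≈⟨ ⊕-congˡ u (≅-sym (⊕-assoc (neg v) v (neg w))) ⟩
    u ⊕ ((neg v ⊕ v) ⊕ neg w)  ≈⟨ ⊕-congˡ u (⊕-congʳ (neg w) (inverseˡ v)) ⟩
    u ⊕ neg w                  ∎
    where open ≅-Reasoning

  ⊕-cancel : ∀ u v → u ⊕ (v ⊕ neg u) ≅ v
  ⊕-cancel u v = ≅-trans (≅-sym (⊕-assoc u v (neg u))) (xyx⁻¹≈y u v)

  ⊕-interchange : ∀ p q r s → (p ⊕ q) ⊕ (r ⊕ s) ≅ (p ⊕ r) ⊕ (q ⊕ s)
  ⊕-interchange p q r s = coeffwise λ i → begin
    coeff ((p ⊕ q) ⊕ (r ⊕ s)) i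
      ≈⟨ trans (coeff-⊕ (p ⊕ q) (r ⊕ s) i) (+-cong (coeff-⊕ p q i) (coeff-⊕ r s i)) ⟩
    (coeff p i + coeff q i) + (coeff r i + coeff s i)
      ≈⟨ solve 4 (λ a b c d → (a :+ b) :+ (c :+ d) := (a :+ c) :+ (b :+ d)) refl _ _ _ _ ⟩
    (coeff p i + coeff r i) + (coeff q i + coeff s i)
      ≈⟨ sym (trans (coeff-⊕ (p ⊕ r) (q ⊕ s) i) (+-cong (coeff-⊕ p r i) (coeff-⊕ q s i))) ⟩
    coeff ((p ⊕ r) ⊕ (q ⊕ s)) i
      ∎
    where open SetoidReasoning setoid

  scale-⊕ : ∀ a p q → scale a (p ⊕ q) ≅ scale a p ⊕ scale a q
  scale-⊕ a p q = coeffwise λ i → begin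
    coeff (scale a (p ⊕ q)) i                ≈⟨ trans (coeff-scale a (p ⊕ q) i) (*-cong refl (coeff-⊕ p q i)) ⟩
    a * (coeff p i + coeff q i)              ≈⟨ distribˡ a _ _ ⟩
    a * coeff p i + a * coeff q i            ≈⟨ sym (trans (coeff-⊕ (scale a p) (scale a q) i)
                                                            (+-cong (coeff-scale a p i) (coeff-scale a q i))) ⟩
    coeff (scale a p ⊕ scale a q) i          ∎
    where open SetoidReasoning setoid

  scale-+ : ∀ a b p → scale (a + b) p ≅ scale a p ⊕ scale b p
  scale-+ a b p = coeffwise λ i → begin
    coeff (scale (a + b) p) i                ≈⟨ coeff-scale (a + b) p i ⟩
    (a + b) * coeff p i                      ≈⟨ distribʳ _ a b ⟩
    a * coeff p i + b * coeff p i            ≈⟨ sym (trans (coeff-⊕ (scale a p) (scale b p) i)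
                                                            (+-cong (coeff-scale a p i) (coeff-scale b p i))) ⟩
    coeff (scale a p ⊕ scale b p) i          ∎
    where open SetoidReasoning setoid

  scale-* : ∀ a b p → scale a (scale b p) ≅ scale (a * b) p
  scale-* a b p = coeffwise λ i → begin
    coeff (scale a (scale b p)) i            ≈⟨ trans (coeff-scale a (scale b p) i) (*-cong refl (coeff-scale b p i)) ⟩
    a * (b * coeff p i)                      ≈⟨ sym (*-assoc a b _) ⟩
    (a * b) * coeff p i                      ≈⟨ sym (coeff-scale (a * b) p i) ⟩
    coeff (scale (a * b) p) i                ∎
    where open SetoidReasoning setoid

  scale-1 : ∀ p → scale 1# p ≅ p
  scale-1 p = coeffwise λ i → trans (coeff-scale 1# p i) (*-identityˡ _)

  scale-0 : ∀ p → scale 0# p ≅ []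
  scale-0 p = coeffwise λ i → trans (coeff-scale 0# p i) (zeroˡ _)

  scale-suc : ∀ n p → scale (fromℕ n) p ⊕ p ≅ scale (fromℕ (suc n)) p
  scale-suc n p = ≅-trans (⊕-comm (scale (fromℕ n) p) p)
    (≅-sym (≅-trans (scale-+ 1# (fromℕ n) p) (⊕-congʳ (scale (fromℕ n) p) (scale-1 p))))

  scale-sumK : ∀ n (a : ℕ → Carrier) p → scale (sumK n a) p ≅ sumPol n (λ k → scale (a k) p)
  scale-sumK zero    a p = scale-0 p
  scale-sumK (suc n) a p = ≅-trans (scale-+ (sumK n a) (a n) p) (⊕-congʳ (scale (a n) p) (scale-sumK n a p))

  sumPol-cong< : ∀ n {f g : ℕ → Pol} → (∀ k → k < n → f k ≅ g k) → sumPol n f ≅ sumPol n g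
  sumPol-cong< zero    e = ≅-refl
  sumPol-cong< (suc n) e = ⊕-cong (sumPol-cong< n λ k k<n → e k (ℕₚ.m<n⇒m<1+n k<n)) (e n (ℕₚ.n<1+n n))

  sumPol-cong : ∀ n {f g : ℕ → Pol} → (∀ k → f k ≅ g k) → sumPol n f ≅ sumPol n g
  sumPol-cong n e = sumPol-cong< n λ k _ → e k

  sumPol-⊕ : ∀ n (f g : ℕ → Pol) → sumPol n (λ k → f k ⊕ g k) ≅ sumPol n f ⊕ sumPol n g
  sumPol-⊕ zero    f g = ≅-refl
  sumPol-⊕ (suc n) f g =
    ≅-trans (⊕-congʳ (f n ⊕ g n) (sumPol-⊕ n f g)) (⊕-interchange (sumPol n f) (sumPol n g) (f n) (g n))

  sumPol-zero : ∀ n {f : ℕ → Pol} → (∀ k → f k ≅ []) → sumPol n f ≅ []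
  sumPol-zero zero    e = ≅-refl
  sumPol-zero (suc n) e = ⊕-cong (sumPol-zero n e) (e n)

  sumPol-suc : ∀ n (f : ℕ → Pol) → sumPol (suc n) f ≅ f 0 ⊕ sumPol n (f ∘ suc)
  sumPol-suc zero    f = ⊕-comm [] (f 0)
  sumPol-suc (suc n) f = ≅-trans (⊕-congʳ (f (suc n)) (sumPol-suc n f)) (⊕-assoc (f 0) _ _)

  sumPol-extend : ∀ {n m} (f : ℕ → Pol) → n ≤′ m → (∀ k → n ≤ k → f k ≅ []) →
                  sumPol m f ≅ sumPol n f
  sumPol-extend f ≤′-refl         vanish = ≅-refl
  sumPol-extend f (≤′-step {m} n≤m) vanish =
    ≅-trans (⊕-cong (sumPol-extend f n≤m vanish) (vanish m (ℕₚ.≤′⇒≤ n≤m))) (⊕-identityʳ _)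

  sumPol-swap : ∀ m n (f : ℕ → ℕ → Pol) →
                sumPol m (λ i → sumPol n (f i)) ≅ sumPol n (λ j → sumPol m (λ i → f i j))
  sumPol-swap zero    n f = ≅-sym (sumPol-zero n λ _ → ≅-refl)
  sumPol-swap (suc m) n f = ≅-trans (⊕-congʳ (sumPol n (f m)) (sumPol-swap m n f)) (≅-sym (sumPol-⊕ n _ _))

  sumPol-triangle : ∀ N (f : ℕ → ℕ → Pol) → sumPol N (λ m → sumPol (suc m) (λ k → f k (m ∸ k)))
                          ≅ sumPol N (λ k → sumPol (N ∸ k) (f k))
  sumPol-triangle zero    f = ≅-refl
  sumPol-triangle (suc N) f = begin
    sumPol N (λ m → sumPol (suc m) (λ k → f k (m ∸ k))) ⊕ sumPol (suc N) (λ k → f k (N ∸ k))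
      ≈⟨ ⊕-congʳ _ (sumPol-triangle N f) ⟩
    sumPol N (λ k → sumPol (N ∸ k) (f k)) ⊕ sumPol (suc N) (λ k → f k (N ∸ k))
      ≈⟨ ⊕-congʳ _ (≅-sym lastRowEmpty) ⟩
    sumPol (suc N) (λ k → sumPol (N ∸ k) (f k)) ⊕ sumPol (suc N) (λ k → f k (N ∸ k))
      ≈⟨ ≅-sym (sumPol-⊕ (suc N) _ _) ⟩
    sumPol (suc N) (λ k → sumPol (suc (N ∸ k)) (f k))
      ≈⟨ sumPol-cong< (suc N) (λ k k<1+N →
           ≡⇒≅ (≡.cong (λ t → sumPol t (f k)) (≡.sym (ℕₚ.+-∸-assoc 1 (ℕₚ.≤-pred k<1+N))))) ⟩
    sumPol (suc N) (λ k → sumPol (suc N ∸ k) (f k))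
      ∎
    where
    open ≅-Reasoning
    lastRowEmpty : sumPol (suc N) (λ k → sumPol (N ∸ k) (f k)) ≅ sumPol N (λ k → sumPol (N ∸ k) (f k))
    lastRowEmpty = ≅-trans
      (⊕-congˡ (sumPol N (λ k → sumPol (N ∸ k) (f k))) (≡⇒≅ (≡.cong (λ t → sumPol t (f N)) (ℕₚ.n∸n≡0 N))))
      (⊕-identityʳ _)

  -- Linear operators

  record IsLinear (A : Pol → Pol) : Set (c ⊔ ℓ) where
    field
      cong       : ∀ {p q} → p ≅ q → A p ≅ A q
      ⊕-homo     : ∀ p q → A (p ⊕ q) ≅ A p ⊕ A q
      scale-homo : ∀ a p → A (scale a p) ≅ scale a (A p)

    []-homo : A [] ≅ []
    []-homo = ≅-trans (scale-homo 0# []) (scale-0 (A []))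

    neg-homo : ∀ p → A (neg p) ≅ neg (A p)
    neg-homo = scale-homo (- 1#)

    sumPol-homo : ∀ n f → A (sumPol n f) ≅ sumPol n (A ∘ f)
    sumPol-homo zero    f = []-homo
    sumPol-homo (suc n) f = ≅-trans (⊕-homo (sumPol n f) (f n)) (⊕-congʳ (A (f n)) (sumPol-homo n f))

    linExt-homo : ∀ φ p → A (linExt φ p) ≅ linExt (A ∘ φ) p
    linExt-homo φ p =
      ≅-trans (sumPol-homo (length p) _) (sumPol-cong (length p) λ i → scale-homo (coeff p i) (φ i))

  ⊕-linear : ∀ {A B} → IsLinear A → IsLinear B → IsLinear (λ p → A p ⊕ B p)
  ⊕-linear {A} {B} A-lin B-lin = record
    { cong       = λ e → ⊕-cong (A.cong e) (B.cong e)
    ; ⊕-homo     = λ p q → ≅-trans (⊕-cong (A.⊕-homo p q) (B.⊕-homo p q))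
                                   (⊕-interchange (A p) (A q) (B p) (B q))
    ; scale-homo = λ a p → ≅-trans (⊕-cong (A.scale-homo a p) (B.scale-homo a p))
                                   (≅-sym (scale-⊕ a (A p) (B p))) }
    where
    module A = IsLinear A-lin
    module B = IsLinear B-lin

  sumPol-linear : ∀ N {A : ℕ → Pol → Pol} → (∀ k → IsLinear (A k)) →
                  IsLinear (λ p → sumPol N (λ k → A k p))
  sumPol-linear zero    A-lin =
    record { cong = λ _ → ≅-refl ; ⊕-homo = λ _ _ → ≅-refl ; scale-homo = λ _ _ → ≅-refl }
  sumPol-linear (suc N) A-lin = ⊕-linear (sumPol-linear N A-lin) (A-lin N)

  ∘-linear : ∀ {A B} → IsLinear A → IsLinear B → IsLinear (A ∘ B)
  ∘-linear A-lin B-lin = record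
    { cong       = A.cong ∘ B.cong
    ; ⊕-homo     = λ p q → ≅-trans (A.cong (B.⊕-homo p q)) (A.⊕-homo _ _)
    ; scale-homo = λ a p → ≅-trans (A.cong (B.scale-homo a p)) (A.scale-homo a _) }
    where
    module A = IsLinear A-lin
    module B = IsLinear B-lin

  powOp-linear : ∀ {A} → IsLinear A → ∀ m → IsLinear (powOp m A)
  powOp-linear A-lin zero    =
    record { cong = λ e → e ; ⊕-homo = λ _ _ → ≅-refl ; scale-homo = λ _ _ → ≅-refl }
  powOp-linear A-lin (suc m) = ∘-linear A-lin (powOp-linear A-lin m)

  scale-linear : ∀ a → IsLinear (scale a)
  scale-linear a = record
    { cong       = scale-cong refl
    ; ⊕-homo     = scale-⊕ a
    ; scale-homo = λ b p →
        ≅-trans (scale-* a b p) (≅-trans (scale-cong (*-comm a b) ≅-refl) (≅-sym (scale-* b a p))) }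

  X̂-linear : IsLinear X̂
  X̂-linear = record
    { cong       = λ (coeffwise e) → coeffwise λ { zero → refl ; (suc i) → e i }
    ; ⊕-homo     = λ p q → coeffwise λ { zero → sym (+-identityʳ 0#) ; (suc i) → refl }
    ; scale-homo = λ a p → coeffwise λ { zero → sym (zeroʳ a) ; (suc i) → refl } }

  weighted-linear : ∀ {A} (w : ℕ → Carrier) (σ : ℕ → ℕ) →
                    (∀ p i → coeff (A p) i ≈ w i * coeff p (σ i)) → IsLinear A
  weighted-linear {A} w σ coeff-A = record
    { cong       = λ {p} {q} (coeffwise e) → coeffwise λ i →
                     trans (coeff-A p i) (trans (*-cong refl (e (σ i))) (sym (coeff-A q i)))
    ; ⊕-homo     = λ p q → coeffwise λ i → begin
        coeff (A (p ⊕ q)) i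
          ≈⟨ trans (coeff-A (p ⊕ q) i) (*-cong refl (coeff-⊕ p q (σ i))) ⟩
        w i * (coeff p (σ i) + coeff q (σ i))
          ≈⟨ distribˡ (w i) _ _ ⟩
        w i * coeff p (σ i) + w i * coeff q (σ i)
          ≈⟨ sym (trans (coeff-⊕ (A p) (A q) i) (+-cong (coeff-A p i) (coeff-A q i))) ⟩
        coeff (A p ⊕ A q) i
          ∎
    ; scale-homo = λ a p → coeffwise λ i → begin
        coeff (A (scale a p)) i
          ≈⟨ trans (coeff-A (scale a p) i) (*-cong refl (coeff-scale a p (σ i))) ⟩
        w i * (a * coeff p (σ i))
          ≈⟨ solve 3 (λ x y z → x :* (y :* z) := y :* (x :* z)) refl (w i) a _ ⟩
        a * (w i * coeff p (σ i))
          ≈⟨ sym (trans (coeff-scale a (A p) i) (*-cong refl (coeff-A p i))) ⟩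
        coeff (scale a (A p)) i
          ∎ }
    where open SetoidReasoning setoid

  linExt-cong< : ∀ {φ ψ} p → (∀ i → i < length p → φ i ≅ ψ i) → linExt φ p ≅ linExt ψ p
  linExt-cong< p e = sumPol-cong< (length p) λ i i<n → scale-cong refl (e i i<n)

  linExt-monomial : ∀ p → linExt monomial p ≅ p
  linExt-monomial []      = ≅-refl
  linExt-monomial (a ∷ p) = begin
    linExt monomial (a ∷ p)
      ≈⟨ sumPol-suc (length p) _ ⟩
    scale a (monomial 0) ⊕ sumPol (length p) (λ i → scale (coeff p i) (X̂ (monomial i)))
      ≈⟨ ⊕-congˡ (scale a (monomial 0)) (≅-sym (IsLinear.linExt-homo X̂-linear monomial p)) ⟩
    scale a (monomial 0) ⊕ X̂ (linExt monomial p)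
      ≈⟨ ⊕-congˡ (scale a (monomial 0)) (IsLinear.cong X̂-linear (linExt-monomial p)) ⟩
    scale a (monomial 0) ⊕ X̂ p
      ≈⟨ coeffwise (λ { zero → trans (+-identityʳ _) (*-identityʳ a) ; (suc i) → refl }) ⟩
    a ∷ p
      ∎
    where open ≅-Reasoning

  -- The derivative and degree bounds

  -- Poly keeps the accumulator of D private; abstracting the literal 1 in the unfolding of
  -- D (a ∷ p) lets unification name it.
  mutual
    derivFrom : ℕ → Pol → Pol
    derivFrom = _

    private
      D-∷ : ∀ a p → D (a ∷ p) ≡ derivFrom 1 p
      D-∷ a p with 1
      ... | k = ≡.refl {x = derivFrom k p}

  coeff-derivFrom : ∀ k p i → coeff (derivFrom k p) i ≈ fromℕ (k ℕ.+ i) * coeff p i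
  coeff-derivFrom k []      i       = sym (zeroʳ _)
  coeff-derivFrom k (a ∷ p) zero    =
    trans (·ℕ≈fromℕ* k a) (*-cong (fromℕ-cong (≡.sym (ℕₚ.+-identityʳ k))) refl)
  coeff-derivFrom k (a ∷ p) (suc i) =
    trans (coeff-derivFrom (suc k) p i) (*-cong (fromℕ-cong (≡.sym (ℕₚ.+-suc k i))) refl)

  coeff-D : ∀ p i → coeff (D p) i ≈ fromℕ (suc i) * coeff p (suc i)
  coeff-D []      i = sym (zeroʳ _)
  coeff-D (a ∷ p) i rewrite D-∷ a p = coeff-derivFrom 1 p i

  D-linear : IsLinear D
  D-linear = weighted-linear (fromℕ ∘ suc) suc coeff-D

  Dpow-linear : ∀ k → IsLinear (Dpow k)
  Dpow-linear zero    = powOp-linear D-linear 0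
  Dpow-linear (suc k) = ∘-linear D-linear (Dpow-linear k)

  D-Dpow : ∀ k p → D (Dpow k p) ≡ Dpow k (D p)
  D-Dpow zero    p = ≡.refl
  D-Dpow (suc k) p = ≡.cong D (D-Dpow k p)

  Dpow-+ : ∀ k j p → Dpow (k ℕ.+ j) p ≡ Dpow k (Dpow j p)
  Dpow-+ zero    j p = ≡.refl
  Dpow-+ (suc k) j p = ≡.cong D (Dpow-+ k j p)

  *-coeff-monomial : ∀ n (w : ℕ → Carrier) i → w i * coeff (monomial n) i ≈ w n * coeff (monomial n) i
  *-coeff-monomial zero    w zero    = refl
  *-coeff-monomial zero    w (suc i) = trans (zeroʳ (w (suc i))) (sym (zeroʳ (w 0)))
  *-coeff-monomial (suc n) w zero    = trans (zeroʳ (w 0)) (sym (zeroʳ (w (suc n))))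
  *-coeff-monomial (suc n) w (suc i) = *-coeff-monomial n (w ∘ suc) i

  D-monomial : ∀ n → D (monomial (suc n)) ≅ scale (fromℕ (suc n)) (monomial n)
  D-monomial n = coeffwise λ i → trans (coeff-D (monomial (suc n)) i)
    (trans (*-coeff-monomial n (fromℕ ∘ suc) i) (sym (coeff-scale (fromℕ (suc n)) (monomial n) i)))

  record DegreeBelow (p : Pol) (n : ℕ) : Set ℓ where
    constructor degreeBelow
    field coeff-≥ : ∀ j → n ≤ j → coeff p j ≈ 0#
  open DegreeBelow public

  length-DegreeBelow : ∀ p → DegreeBelow p (length p)
  length-DegreeBelow p = degreeBelow (go p)
    where
    go : ∀ p j → length p ≤ j → coeff p j ≈ 0#
    go []      j       _         = refl
    go (a ∷ p) (suc j) (s≤s n≤j) = go p j n≤j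

  DegreeBelow-mono : ∀ {p m n} → m ≤ n → DegreeBelow p m → DegreeBelow p n
  DegreeBelow-mono m≤n (degreeBelow deg) = degreeBelow λ j n≤j → deg j (ℕₚ.≤-trans m≤n n≤j)

  DegreeBelow-resp : ∀ {p q n} → p ≅ q → DegreeBelow p n → DegreeBelow q n
  DegreeBelow-resp (coeffwise e) (degreeBelow deg) = degreeBelow λ j n≤j → trans (sym (e j)) (deg j n≤j)

  DegreeBelow-⊕ : ∀ {p q n} → DegreeBelow p n → DegreeBelow q n → DegreeBelow (p ⊕ q) n
  DegreeBelow-⊕ {p} {q} (degreeBelow degp) (degreeBelow degq) = degreeBelow λ j n≤j →
    trans (coeff-⊕ p q j) (trans (+-cong (degp j n≤j) (degq j n≤j)) (+-identityʳ 0#))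

  DegreeBelow-scale : ∀ {p n} a → DegreeBelow p n → DegreeBelow (scale a p) n
  DegreeBelow-scale {p} a (degreeBelow deg) = degreeBelow λ j n≤j →
    trans (coeff-scale a p j) (trans (*-cong refl (deg j n≤j)) (zeroʳ a))

  DegreeBelow-sumPol : ∀ {n} N f → (∀ k → DegreeBelow (f k) n) → DegreeBelow (sumPol N f) n
  DegreeBelow-sumPol zero    f deg = degreeBelow λ _ _ → refl
  DegreeBelow-sumPol (suc N) f deg = DegreeBelow-⊕ (DegreeBelow-sumPol N f deg) (deg N)

  DegreeBelow-0 : ∀ {p} → DegreeBelow p 0 → p ≅ []
  DegreeBelow-0 (degreeBelow deg) = coeffwise λ j → deg j z≤n

  D-DegreeBelow : ∀ {p n} → DegreeBelow p (suc n) → DegreeBelow (D p) n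
  D-DegreeBelow {p} (degreeBelow deg) = degreeBelow λ j n≤j →
    trans (coeff-D p j) (trans (*-cong refl (deg (suc j) (s≤s n≤j))) (zeroʳ _))

  Dpow-DegreeBelow : ∀ k {p n} → DegreeBelow p (k ℕ.+ n) → DegreeBelow (Dpow k p) n
  Dpow-DegreeBelow zero    deg = deg
  Dpow-DegreeBelow (suc k) {p} {n} deg =
    D-DegreeBelow (Dpow-DegreeBelow k (≡.subst (DegreeBelow p) (≡.sym (ℕₚ.+-suc k n)) deg))

  Dpow-preserves-DegreeBelow : ∀ k {p n} → DegreeBelow p n → DegreeBelow (Dpow k p) n
  Dpow-preserves-DegreeBelow k {n = n} deg = Dpow-DegreeBelow k (DegreeBelow-mono (ℕₚ.m≤n+m n k) deg)

  Dpow-vanish : ∀ {k p n} → DegreeBelow p n → n ≤ k → Dpow k p ≅ []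
  Dpow-vanish {k} deg n≤k =
    DegreeBelow-0 (Dpow-DegreeBelow k (DegreeBelow-mono (ℕₚ.≤-trans n≤k (ℕₚ.m≤m+n k 0)) deg))

  D-kernel : ∀ {p} → D p ≅ [] → DegreeBelow p 1
  D-kernel {p} (coeffwise Dp≈0) = degreeBelow λ where
    (suc i) _ → *-cancel-≉0 (fromℕ-suc≉0 i) (trans (sym (coeff-D p i)) (Dp≈0 i))

  -- The Pincherle derivative

  pincherle-cong : ∀ {A B} → (∀ p → A p ≅ B p) → ∀ p → pincherle A p ≅ pincherle B p
  pincherle-cong A≅B p = ⊕-cong (A≅B (X̂ p)) (neg-cong (IsLinear.cong X̂-linear (A≅B p)))

  pincherle-linear : ∀ {A} → IsLinear A → IsLinear (pincherle A)
  pincherle-linear A-lin =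
    ⊕-linear (∘-linear A-lin X̂-linear) (∘-linear (scale-linear (- 1#)) (∘-linear X̂-linear A-lin))

  X̂-commutator : ∀ A p → A (X̂ p) ≅ X̂ (A p) ⊕ pincherle A p
  X̂-commutator A p = ≅-sym (⊕-cancel (X̂ (A p)) (A (X̂ p)))

  pincherle-∘ : ∀ {A} → IsLinear A → ∀ B p → pincherle (A ∘ B) p ≅ A (pincherle B p) ⊕ pincherle A (B p)
  pincherle-∘ {A} A-lin B p = ≅-sym (begin
    A (B (X̂ p) ⊕ neg (X̂ (B p))) ⊕ pincherle A (B p)
      ≈⟨ ⊕-congʳ (pincherle A (B p))
           (≅-trans (A.⊕-homo _ _) (⊕-congˡ (A (B (X̂ p))) (A.neg-homo (X̂ (B p))))) ⟩
    (A (B (X̂ p)) ⊕ neg (A (X̂ (B p)))) ⊕ (A (X̂ (B p)) ⊕ neg (X̂ (A (B p))))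
      ≈⟨ ⊕-telescope (A (B (X̂ p))) (A (X̂ (B p))) (X̂ (A (B p))) ⟩
    pincherle (A ∘ B) p
      ∎)
    where
    open ≅-Reasoning
    module A = IsLinear A-lin

  pincherle-combination : ∀ N (s : ℕ → Carrier) (A : ℕ → Pol → Pol) p →
    pincherle (λ x → sumPol N (λ k → scale (s k) (A k x))) p ≅ sumPol N (λ k → scale (s k) (pincherle (A k) p))
  pincherle-combination N s A p = begin
    sumPol N (λ k → scale (s k) (A k (X̂ p))) ⊕ negX̂ (sumPol N (λ k → scale (s k) (A k p)))
      ≈⟨ ⊕-congˡ (sumPol N (λ k → scale (s k) (A k (X̂ p)))) (negX̂.sumPol-homo N _) ⟩
    sumPol N (λ k → scale (s k) (A k (X̂ p))) ⊕ sumPol N (λ k → negX̂ (scale (s k) (A k p)))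
      ≈⟨ ≅-sym (sumPol-⊕ N _ _) ⟩
    sumPol N (λ k → scale (s k) (A k (X̂ p)) ⊕ negX̂ (scale (s k) (A k p)))
      ≈⟨ sumPol-cong N (λ k → ≅-trans (⊕-congˡ (scale (s k) (A k (X̂ p))) (negX̂.scale-homo (s k) (A k p)))
                                       (≅-sym (scale-⊕ (s k) (A k (X̂ p)) (neg (X̂ (A k p)))))) ⟩
    sumPol N (λ k → scale (s k) (pincherle (A k) p))
      ∎
    where
    open ≅-Reasoning
    negX̂ : Pol → Pol
    negX̂ = neg ∘ X̂
    module negX̂ = IsLinear (∘-linear (scale-linear (- 1#)) X̂-linear)

  pincherle-D : ∀ p → pincherle D p ≅ p
  pincherle-D p = coeffwise λ where
      zero    → trans (coeff-⊕ (D (X̂ p)) (neg (X̂ (D p))) 0)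
                  (trans (+-cong (coeff-D (X̂ p) 0) (coeff-neg (X̂ (D p)) 0))
                  (trans (+-cong (trans (*-cong fromℕ-1 refl) (*-identityˡ _)) -0#≈0#) (+-identityʳ _)))
      (suc i) → trans (coeff-⊕ (D (X̂ p)) (neg (X̂ (D p))) (suc i))
                  (trans (+-cong (coeff-D (X̂ p) (suc i)) (trans (coeff-neg (X̂ (D p)) (suc i)) (-‿cong (coeff-D p i))))
                  (cancel (fromℕ (suc i)) (coeff p (suc i))))
    where
    cancel : ∀ a x → (1# + a) * x + - (a * x) ≈ x
    cancel a x = begin
      (1# + a) * x + - (a * x)       ≈⟨ +-cong (distribʳ x 1# a) refl ⟩
      (1# * x + a * x) + - (a * x)   ≈⟨ +-assoc _ _ _ ⟩
      1# * x + (a * x + - (a * x))   ≈⟨ +-cong (*-identityˡ x) (-‿inverseʳ _) ⟩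
      x + 0#                         ≈⟨ +-identityʳ x ⟩
      x                              ∎
      where open SetoidReasoning setoid

  pincherle-Dpow : ∀ k p → pincherle (Dpow (suc k)) p ≅ scale (fromℕ (suc k)) (Dpow k p)
  pincherle-Dpow zero    p = ≅-trans (pincherle-D p) (≅-sym (≅-trans (scale-cong fromℕ-1 ≅-refl) (scale-1 p)))
  pincherle-Dpow (suc k) p = begin
    pincherle (D ∘ Dpow (suc k)) p
      ≈⟨ pincherle-∘ D-linear (Dpow (suc k)) p ⟩
    D (pincherle (Dpow (suc k)) p) ⊕ pincherle D (Dpow (suc k) p)
      ≈⟨ ⊕-cong (IsLinear.cong D-linear (pincherle-Dpow k p)) (pincherle-D (Dpow (suc k) p)) ⟩
    D (scale (fromℕ (suc k)) (Dpow k p)) ⊕ Dpow (suc k) p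
      ≈⟨ ⊕-congʳ (Dpow (suc k) p) (IsLinear.scale-homo D-linear (fromℕ (suc k)) (Dpow k p)) ⟩
    scale (fromℕ (suc k)) (Dpow (suc k) p) ⊕ Dpow (suc k) p
      ≈⟨ scale-suc (suc k) (Dpow (suc k) p) ⟩
    scale (fromℕ (suc (suc k))) (Dpow (suc k) p)
      ∎
    where open ≅-Reasoning

  -- Shift-invariant operators

  -- applyPS s p = partialPS s (length p) p
  partialPS : PS → ℕ → Pol → Pol
  partialPS s N p = sumPol N (λ k → scale (s k) (Dpow k p))

  derivPS : PS → PS
  derivPS s k = fromℕ (suc k) * s (suc k)

  partialPS-linear : ∀ s N → IsLinear (partialPS s N)
  partialPS-linear s N = sumPol-linear N λ k → ∘-linear (scale-linear (s k)) (Dpow-linear k)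

  partialPS-extend : ∀ s {p m n} → DegreeBelow p n → n ≤ m → partialPS s m p ≅ partialPS s n p
  partialPS-extend s deg n≤m =
    sumPol-extend _ (ℕₚ.≤⇒≤′ n≤m) λ k n≤k → scale-cong refl (Dpow-vanish deg n≤k)

  applyPS-partialPS : ∀ s {p N} → DegreeBelow p N → applyPS s p ≅ partialPS s N p
  applyPS-partialPS s {p} {N} deg = ≅-trans
    (≅-sym (partialPS-extend s (length-DegreeBelow p) (ℕₚ.m≤n+m (length p) N)))
    (partialPS-extend s deg (ℕₚ.m≤m+n N (length p)))

  applyPS-DegreeBelow : ∀ s {p n} → DegreeBelow p n → DegreeBelow (applyPS s p) n
  applyPS-DegreeBelow s {p} deg =
    DegreeBelow-sumPol (length p) _ λ k → DegreeBelow-scale (s k) (Dpow-preserves-DegreeBelow k deg)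

  applyPS-linear : ∀ s → IsLinear (applyPS s)
  applyPS-linear s = record
    { cong       = λ {p} {q} p≅q → ≅-trans (applyPS-partialPS s (bound₁ p q))
                                    (≅-trans (IsLinear.cong (partial p q) p≅q) (≅-sym (applyPS-partialPS s (bound₂ p q))))
    ; ⊕-homo     = λ p q → ≅-trans (applyPS-partialPS s (DegreeBelow-⊕ (bound₁ p q) (bound₂ p q)))
                             (≅-trans (IsLinear.⊕-homo (partial p q) p q)
                             (≅-sym (⊕-cong (applyPS-partialPS s (bound₁ p q)) (applyPS-partialPS s (bound₂ p q)))))
    ; scale-homo = λ a p → ≅-trans (applyPS-partialPS s (DegreeBelow-scale a (length-DegreeBelow p)))
                             (IsLinear.scale-homo (partialPS-linear s (length p)) a p) }
    where
    partial : ∀ p q → IsLinear (partialPS s (length p ℕ.+ length q))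
    partial p q = partialPS-linear s (length p ℕ.+ length q)
    bound₁ : ∀ p q → DegreeBelow p (length p ℕ.+ length q)
    bound₁ p q = DegreeBelow-mono (ℕₚ.m≤m+n _ _) (length-DegreeBelow p)
    bound₂ : ∀ p q → DegreeBelow q (length p ℕ.+ length q)
    bound₂ p q = DegreeBelow-mono (ℕₚ.m≤n+m _ _) (length-DegreeBelow q)

  applyPS-congˡ : ∀ {s t} → (∀ k → s k ≈ t k) → ∀ p → applyPS s p ≅ applyPS t p
  applyPS-congˡ s≈t p = sumPol-cong (length p) λ k → scale-cong (s≈t k) ≅-refl

  applyPS-split : ∀ s p →
    applyPS s p ≅ scale (s 0) p ⊕ sumPol (length p) (λ k → scale (s (suc k)) (D (Dpow k p)))
  applyPS-split s p = ≅-trans (applyPS-partialPS s (DegreeBelow-mono (ℕₚ.n≤1+n _) (length-DegreeBelow p)))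
                              (sumPol-suc (length p) _)

  applyPS-onePS : ∀ p → applyPS onePS p ≅ p
  applyPS-onePS p = ≅-trans (applyPS-split onePS p)
    (≅-trans (⊕-cong (scale-1 p) (sumPol-zero (length p) λ k → scale-0 (D (Dpow k p)))) (⊕-identityʳ p))

  applyPS-minusOne : ∀ s p → applyPS s p ≅ applyPS (minusOne s) p ⊕ p
  applyPS-minusOne s p = begin
    applyPS s p
      ≈⟨ applyPS-split s p ⟩
    scale (s 0) p ⊕ rest
      ≈⟨ ⊕-congʳ rest (≅-sym (≅-trans (⊕-congˡ (scale (s 0 - 1#) p) (≅-sym (scale-1 p)))
                                     (≅-trans (≅-sym (scale-+ (s 0 - 1#) 1# p)) (scale-cong minus-plus ≅-refl)))) ⟩
    (scale (s 0 - 1#) p ⊕ p) ⊕ rest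
      ≈⟨ ≅-trans (⊕-assoc (scale (s 0 - 1#) p) p rest)
           (≅-trans (⊕-congˡ (scale (s 0 - 1#) p) (⊕-comm p rest))
                    (≅-sym (⊕-assoc (scale (s 0 - 1#) p) rest p))) ⟩
    (scale (s 0 - 1#) p ⊕ rest) ⊕ p
      ≈⟨ ⊕-congʳ p (≅-sym (applyPS-split (minusOne s) p)) ⟩
    applyPS (minusOne s) p ⊕ p
      ∎
    where
    open ≅-Reasoning
    rest = sumPol (length p) (λ k → scale (s (suc k)) (D (Dpow k p)))
    minus-plus : (s 0 - 1#) + 1# ≈ s 0
    minus-plus = trans (+-assoc _ _ _) (trans (+-cong refl (-‿inverseˡ 1#)) (+-identityʳ _))

  D-applyPS : ∀ s p → D (applyPS s p) ≅ applyPS s (D p)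
  D-applyPS s p = begin
    D (partialPS s L p)
      ≈⟨ D.sumPol-homo L _ ⟩
    sumPol L (λ k → D (scale (s k) (Dpow k p)))
      ≈⟨ sumPol-cong L (λ k → ≅-trans (D.scale-homo (s k) (Dpow k p)) (scale-cong refl (≡⇒≅ (D-Dpow k p)))) ⟩
    partialPS s L (D p)
      ≈⟨ ≅-sym (applyPS-partialPS s (D-DegreeBelow (DegreeBelow-mono (ℕₚ.n≤1+n L) (length-DegreeBelow p)))) ⟩
    applyPS s (D p)
      ∎
    where
    open ≅-Reasoning
    module D = IsLinear D-linear
    L = length p

  applyPS-divD : ∀ s → s 0 ≈ 0# → ∀ p → applyPS s p ≅ D (applyPS (divD s) p)
  applyPS-divD s s₀≈0 p = begin
    applyPS s p
      ≈⟨ applyPS-split s p ⟩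
    scale (s 0) p ⊕ sumPol L (λ k → scale (divD s k) (D (Dpow k p)))
      ≈⟨ ⊕-congʳ _ (≅-trans (scale-cong s₀≈0 ≅-refl) (scale-0 p)) ⟩
    sumPol L (λ k → scale (divD s k) (D (Dpow k p)))
      ≈⟨ sumPol-cong L (λ k → ≅-sym (IsLinear.scale-homo D-linear (divD s k) (Dpow k p))) ⟩
    sumPol L (λ k → D (scale (divD s k) (Dpow k p)))
      ≈⟨ ≅-sym (IsLinear.sumPol-homo D-linear L _) ⟩
    D (applyPS (divD s) p)
      ∎
    where
    open ≅-Reasoning
    L = length p

  pincherle-applyPS : ∀ s p → pincherle (applyPS s) p ≅ applyPS (derivPS s) p
  pincherle-applyPS s p = begin
    applyPS s (X̂ p) ⊕ neg (X̂ (applyPS s p))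
      ≈⟨ ⊕-congˡ (applyPS s (X̂ p)) (neg-cong (IsLinear.cong X̂-linear
           (applyPS-partialPS s (DegreeBelow-mono (ℕₚ.n≤1+n L) (length-DegreeBelow p))))) ⟩
    pincherle (partialPS s (suc L)) p
      ≈⟨ pincherle-combination (suc L) s Dpow p ⟩
    sumPol (suc L) (λ k → scale (s k) (pincherle (Dpow k) p))
      ≈⟨ sumPol-suc L _ ⟩
    scale (s 0) (X̂ p ⊕ neg (X̂ p)) ⊕ sumPol L (λ k → scale (s (suc k)) (pincherle (Dpow (suc k)) p))
      ≈⟨ ⊕-cong (scale-cong refl (⊕-inverseʳ (X̂ p)))
                (sumPol-cong L λ k → ≅-trans (scale-cong refl (pincherle-Dpow k p))
                                    (≅-trans (scale-* (s (suc k)) _ (Dpow k p)) (scale-cong (*-comm _ _) ≅-refl))) ⟩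
    applyPS (derivPS s) p
      ∎
    where
    open ≅-Reasoning
    L = length p

  applyPS-∘-expanded : ∀ s t p → applyPS s (applyPS t p)
    ≅ sumPol (length p) (λ k → sumPol (length p) (λ j → scale (s k * t j) (Dpow (k ℕ.+ j) p)))
  applyPS-∘-expanded s t p = begin
    applyPS s (applyPS t p)
      ≈⟨ applyPS-partialPS s (applyPS-DegreeBelow t (length-DegreeBelow p)) ⟩
    sumPol L (λ k → scale (s k) (Dpow k (applyPS t p)))
      ≈⟨ sumPol-cong L (λ k → IsLinear.sumPol-homo (∘-linear (scale-linear (s k)) (Dpow-linear k)) L _) ⟩
    sumPol L (λ k → sumPol L (λ j → scale (s k) (Dpow k (scale (t j) (Dpow j p)))))
      ≈⟨ sumPol-cong L (λ k → sumPol-cong L λ j →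
           ≅-trans (scale-cong refl (IsLinear.scale-homo (Dpow-linear k) (t j) (Dpow j p)))
           (≅-trans (scale-* (s k) (t j) _) (scale-cong refl (≡⇒≅ (≡.sym (Dpow-+ k j p)))))) ⟩
    sumPol L (λ k → sumPol L (λ j → scale (s k * t j) (Dpow (k ℕ.+ j) p)))
      ∎
    where
    open ≅-Reasoning
    L = length p

  applyPS-∘ : ∀ s t p → applyPS s (applyPS t p) ≅ applyPS (s ⋆ t) p
  applyPS-∘ s t p = ≅-sym (begin
    sumPol L (λ m → scale ((s ⋆ t) m) (Dpow m p))
      ≈⟨ sumPol-cong L (λ m → scale-sumK (suc m) _ (Dpow m p)) ⟩
    sumPol L (λ m → sumPol (suc m) (λ i → scale (s i * t (m ∸ i)) (Dpow m p)))
      ≈⟨ sumPol-cong L (λ m → sumPol-cong< (suc m) λ i i<1+m →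
           scale-cong refl (≡⇒≅ (≡.cong (λ n → Dpow n p) (≡.sym (ℕₚ.m+[n∸m]≡n (ℕₚ.≤-pred i<1+m)))))) ⟩
    sumPol L (λ m → sumPol (suc m) (λ i → term i (m ∸ i)))
      ≈⟨ sumPol-triangle L term ⟩
    sumPol L (λ i → sumPol (L ∸ i) (term i))
      ≈⟨ sumPol-cong L (λ i → ≅-sym (sumPol-extend (term i) (ℕₚ.≤⇒≤′ (ℕₚ.m∸n≤m L i)) λ j L∸i≤j →
           scale-cong refl (Dpow-vanish (length-DegreeBelow p)
                              (ℕₚ.≤-trans (ℕₚ.m≤n+m∸n L i) (ℕₚ.+-monoʳ-≤ i L∸i≤j))))) ⟩
    sumPol L (λ i → sumPol L (term i))
      ≈⟨ ≅-sym (applyPS-∘-expanded s t p) ⟩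
    applyPS s (applyPS t p)
      ∎)
    where
    open ≅-Reasoning
    L = length p
    term : ℕ → ℕ → Pol
    term i j = scale (s i * t j) (Dpow (i ℕ.+ j) p)

  applyPS-comm : ∀ s t p → applyPS s (applyPS t p) ≅ applyPS t (applyPS s p)
  applyPS-comm s t p = begin
    applyPS s (applyPS t p)
      ≈⟨ applyPS-∘-expanded s t p ⟩
    sumPol L (λ k → sumPol L (λ j → scale (s k * t j) (Dpow (k ℕ.+ j) p)))
      ≈⟨ sumPol-swap L L _ ⟩
    sumPol L (λ j → sumPol L (λ k → scale (s k * t j) (Dpow (k ℕ.+ j) p)))
      ≈⟨ sumPol-cong L (λ j → sumPol-cong L λ k →
           scale-cong (*-comm (s k) (t j)) (≡⇒≅ (≡.cong (λ n → Dpow n p) (ℕₚ.+-comm k j)))) ⟩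
    sumPol L (λ j → sumPol L (λ k → scale (t j * s k) (Dpow (j ℕ.+ k) p)))
      ≈⟨ ≅-sym (applyPS-∘-expanded t s p) ⟩
    applyPS t (applyPS s p)
      ∎
    where
    open ≅-Reasoning
    L = length p

  -- Generalised exponentiation

  -- binomOp's local accumulator is named the same way; it also takes binomOp's argument.
  mutual
    binomFrom : ℕ → Pol → ℕ → Pol → Pol
    binomFrom = _

    private
      binomOp-∷ : ∀ m a p → binomOp m (a ∷ p) ≡ ((1 C m) ·ℕ a) ∷ binomFrom m (a ∷ p) 1 p
      binomOp-∷ m a p with a ∷ p | 1
      ... | p′ | k = ≡.refl {x = ((k C m) ·ℕ a) ∷ binomFrom m p′ k p}

  coeff-binomFrom : ∀ m p₀ k p i → coeff (binomFrom m p₀ k p) i ≈ fromℕ (suc (k ℕ.+ i) C m) * coeff p i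
  coeff-binomFrom m p₀ k []      i       = sym (zeroʳ _)
  coeff-binomFrom m p₀ k (a ∷ p) zero    =
    trans (·ℕ≈fromℕ* (suc k C m) a)
          (*-cong (fromℕ-cong (≡.cong (λ n → suc n C m) (≡.sym (ℕₚ.+-identityʳ k)))) refl)
  coeff-binomFrom m p₀ k (a ∷ p) (suc i) =
    trans (coeff-binomFrom m p₀ (suc k) p i)
          (*-cong (fromℕ-cong (≡.cong (λ n → suc n C m) (≡.sym (ℕₚ.+-suc k i)))) refl)

  coeff-binomOp : ∀ m p i → coeff (binomOp m p) i ≈ fromℕ (suc i C m) * coeff p i
  coeff-binomOp m []      i = sym (zeroʳ _)
  coeff-binomOp m (a ∷ p) i rewrite binomOp-∷ m a p = coeff-binomFrom m (a ∷ p) 0 (a ∷ p) i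

  binomOp-linear : ∀ m → IsLinear (binomOp m)
  binomOp-linear m = weighted-linear (λ i → fromℕ (suc i C m)) (λ i → i) (coeff-binomOp m)

  binomOp-monomial : ∀ m n → binomOp m (monomial n) ≅ scale (fromℕ (suc n C m)) (monomial n)
  binomOp-monomial m n = coeffwise λ i → trans (coeff-binomOp m (monomial n) i)
    (trans (*-coeff-monomial n (λ j → fromℕ (suc j C m)) i) (sym (coeff-scale _ (monomial n) i)))

  binomOp-vanish : ∀ {m n p} → DegreeBelow p n → n < m → binomOp m p ≅ []
  binomOp-vanish {m} {n} {p} (degreeBelow deg) n<m = coeffwise λ i → trans (coeff-binomOp m p i) (vanish i)
    where
    vanish : ∀ i → fromℕ (suc i C m) * coeff p i ≈ 0#
    vanish i with i ℕ.<? n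
    ... | yes i<n = trans (*-cong (fromℕ-cong (k>n⇒nCk≡0 (ℕₚ.≤-<-trans i<n n<m))) refl) (zeroˡ _)
    ... | no  i≮n = trans (*-cong refl (deg i (ℕₚ.≮⇒≥ i≮n))) (zeroʳ _)

  sumPol-pascal : ∀ N (a : ℕ → Pol) →
    sumPol (suc (suc N)) (λ m → scale (fromℕ (suc N C m)) (a m))
      ≅ sumPol (suc N) (λ m → scale (fromℕ (N C m)) (a (suc m)))
        ⊕ sumPol (suc N) (λ m → scale (fromℕ (N C m)) (a m))
  sumPol-pascal N a = begin
    sumPol (suc (suc N)) (λ m → scale (fromℕ (suc N C m)) (a m))
      ≈⟨ sumPol-suc (suc N) _ ⟩
    a₀ ⊕ sumPol (suc N) (λ m → scale (fromℕ (suc N C suc m)) (a (suc m)))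
      ≈⟨ ⊕-congˡ a₀ (sumPol-cong (suc N) λ m → ≅-trans
           (scale-cong (fromℕ-cong (≡.sym (nCk+nC[k+1]≡[n+1]C[k+1] N m))) ≅-refl)
           (≅-trans (scale-cong (×-homo-+ 1# (N C m) (N C suc m)) ≅-refl) (scale-+ _ _ (a (suc m))))) ⟩
    a₀ ⊕ sumPol (suc N) (λ m → scale (fromℕ (N C m)) (a (suc m)) ⊕ scale (fromℕ (N C suc m)) (a (suc m)))
      ≈⟨ ⊕-congˡ a₀ (sumPol-⊕ (suc N) _ _) ⟩
    a₀ ⊕ (shifted ⊕ sumPol (suc N) (λ m → scale (fromℕ (N C suc m)) (a (suc m))))
      ≈⟨ ⊕-congˡ a₀ (⊕-congˡ shifted (sumPol-extend (λ m → scale (fromℕ (N C suc m)) (a (suc m)))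
           (≤′-step {N} ≤′-refl)
           λ k N≤k → ≅-trans (scale-cong (fromℕ-cong (k>n⇒nCk≡0 (s≤s N≤k))) ≅-refl) (scale-0 (a (suc k))))) ⟩
    a₀ ⊕ (shifted ⊕ sumPol N (λ m → scale (fromℕ (N C suc m)) (a (suc m))))
      ≈⟨ ≅-trans (≅-sym (⊕-assoc a₀ shifted _))
           (≅-trans (⊕-congʳ _ (⊕-comm a₀ shifted)) (⊕-assoc shifted a₀ _)) ⟩
    shifted ⊕ (a₀ ⊕ sumPol N (λ m → scale (fromℕ (N C suc m)) (a (suc m))))
      ≈⟨ ⊕-congˡ shifted (≅-sym (sumPol-suc N _)) ⟩
    shifted ⊕ sumPol (suc N) (λ m → scale (fromℕ (N C m)) (a m))
      ∎
    where
    open ≅-Reasoning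
    a₀ = scale (fromℕ (N C 0)) (a 0)
    shifted = sumPol (suc N) (λ m → scale (fromℕ (N C m)) (a (suc m)))

  powOp-binomial : ∀ {A R} → IsLinear A → IsLinear R → (∀ p → R p ≅ A p ⊕ p) → ∀ N p →
             sumPol (suc N) (λ m → scale (fromℕ (N C m)) (powOp m A p)) ≅ powOp N R p
  powOp-binomial A-lin R-lin R≅A+1 zero    p = ≅-trans (scale-cong fromℕ-1 ≅-refl) (scale-1 p)
  powOp-binomial {A} {R} A-lin R-lin R≅A+1 (suc N) p = begin
    sumPol (suc (suc N)) (λ m → scale (fromℕ (suc N C m)) (powOp m A p))
      ≈⟨ sumPol-pascal N (λ m → powOp m A p) ⟩
    sumPol (suc N) (λ m → scale (fromℕ (N C m)) (A (powOp m A p))) ⊕ binomialSum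
      ≈⟨ ⊕-congʳ binomialSum (≅-sym (≅-trans (IsLinear.sumPol-homo A-lin (suc N) _)
                                     (sumPol-cong (suc N) λ m → IsLinear.scale-homo A-lin _ _))) ⟩
    A binomialSum ⊕ binomialSum
      ≈⟨ ≅-sym (R≅A+1 binomialSum) ⟩
    R binomialSum
      ≈⟨ IsLinear.cong R-lin (powOp-binomial A-lin R-lin R≅A+1 N p) ⟩
    R (powOp N R p)
      ∎
    where
    open ≅-Reasoning
    binomialSum = sumPol (suc N) (λ m → scale (fromℕ (N C m)) (powOp m A p))

  length-monomial : ∀ n → length (monomial n) ≡ suc n
  length-monomial zero    = ≡.refl
  length-monomial (suc n) = ≡.cong suc (length-monomial n)

  monomial-DegreeBelow : ∀ n → DegreeBelow (monomial n) (suc n)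
  monomial-DegreeBelow n = ≡.subst (DegreeBelow (monomial n)) (length-monomial n) (length-DegreeBelow (monomial n))

  -- expXD1 U p = expUpTo U (suc (length p)) p
  expUpTo : PS → ℕ → Pol → Pol
  expUpTo U N p = sumPol N (λ m → powOp m (applyPS (minusOne U)) (binomOp m p))

  expUpTo-linear : ∀ U N → IsLinear (expUpTo U N)
  expUpTo-linear U N =
    sumPol-linear N λ m → ∘-linear (powOp-linear (applyPS-linear (minusOne U)) m) (binomOp-linear m)

  expUpTo-extend : ∀ U {N n p} → DegreeBelow p n → n < N → expUpTo U N p ≅ expUpTo U (suc n) p
  expUpTo-extend U deg n<N = sumPol-extend _ (ℕₚ.≤⇒≤′ n<N) λ m n<m →
    ≅-trans (IsLinear.cong (Aᵐ m) (binomOp-vanish deg n<m)) (IsLinear.[]-homo (Aᵐ m))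
    where Aᵐ = powOp-linear (applyPS-linear (minusOne U))

  expUpTo-monomial : ∀ U n → expUpTo U (suc (suc n)) (monomial n) ≅ powOp (suc n) (applyPS U) (monomial n)
  expUpTo-monomial U n = ≅-trans
    (sumPol-cong (suc (suc n)) λ m →
       ≅-trans (IsLinear.cong (Aᵐ m) (binomOp-monomial m n)) (IsLinear.scale-homo (Aᵐ m) _ _))
    (powOp-binomial (applyPS-linear (minusOne U)) (applyPS-linear U) (applyPS-minusOne U) (suc n) (monomial n))
    where Aᵐ = powOp-linear (applyPS-linear (minusOne U))

  expXD1-monomial : ∀ U n → expXD1 U (monomial n) ≅ powOp (suc n) (applyPS U) (monomial n)
  expXD1-monomial U n = ≅-trans (≡⇒≅ (≡.cong (λ L → expUpTo U (suc L) (monomial n)) (length-monomial n)))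
                                (expUpTo-monomial U n)

  expXD1-linExt : ∀ U p → expXD1 U p ≅ linExt (λ i → powOp (suc i) (applyPS U) (monomial i)) p
  expXD1-linExt U p = begin
    expUpTo U (suc L) p
      ≈⟨ E.cong (≅-sym (linExt-monomial p)) ⟩
    expUpTo U (suc L) (linExt monomial p)
      ≈⟨ E.linExt-homo monomial p ⟩
    linExt (expUpTo U (suc L) ∘ monomial) p
      ≈⟨ linExt-cong< p (λ i i<L →
           ≅-trans (expUpTo-extend U (monomial-DegreeBelow i) (s≤s i<L)) (expUpTo-monomial U i)) ⟩
    linExt (λ i → powOp (suc i) (applyPS U) (monomial i)) p
      ∎
    where
    open ≅-Reasoning
    L = length p
    module E = IsLinear (expUpTo-linear U (suc L))

  -- The transfer formulas

  -- The coefficient of x in Q x = q₀ x + q₁ is q₀.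
  IsDelta-constantTerm : ∀ {q} → IsDelta q → q 0 ≈ 0#
  IsDelta-constantTerm {q} (_ , _ , Qx≋a) = trans (sym (*-identityʳ (q 0))) (Qx≋a 1)

  module Transfer (q : PS) (q₀≈0 : q 0 ≈ 0#) (r : PS) (r-inverse : IsDoverQ q r) where

    Q P R P′ : Pol → Pol
    Q  = applyPS q
    P  = applyPS (divD q)
    R  = applyPS r
    P′ = applyPS (derivPS (divD q))

    private
      module Q = IsLinear (applyPS-linear q)
      module R = IsLinear (applyPS-linear r)
      module Rⁿ n = IsLinear (powOp-linear (applyPS-linear r) n)
      module P′Rⁿ n = IsLinear (∘-linear (applyPS-linear (derivPS (divD q))) (powOp-linear (applyPS-linear r) n))

    Q≅DP : ∀ p → Q p ≅ D (P p)
    Q≅DP = applyPS-divD q q₀≈0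

    P∘R≅id : ∀ p → P (R p) ≅ p
    P∘R≅id p = ≅-trans (applyPS-∘ (divD q) r p) (≅-trans (applyPS-congˡ r-inverse p) (applyPS-onePS p))

    R∘P≅id : ∀ p → R (P p) ≅ p
    R∘P≅id p = ≅-trans (applyPS-comm r (divD q) p) (P∘R≅id p)

    pincherle-Q : ∀ p → pincherle Q p ≅ D (P′ p) ⊕ P p
    pincherle-Q p = ≅-trans (pincherle-cong Q≅DP p) (≅-trans (pincherle-∘ D-linear P p)
      (⊕-cong (IsLinear.cong D-linear (pincherle-applyPS (divD q) p)) (pincherle-D (P p))))

    -- Differentiate P R = 1.
    pincherle-R : ∀ p → pincherle R p ≅ neg (P′ (R (R p)))
    pincherle-R p = begin
      pincherle R p             ≈⟨ ≅-sym (R∘P≅id _) ⟩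
      R (P (pincherle R p))     ≈⟨ R.cong P-pincherle-R ⟩
      R (neg (P′ (R p)))        ≈⟨ R.neg-homo (P′ (R p)) ⟩
      neg (R (P′ (R p)))        ≈⟨ neg-cong (applyPS-comm r _ (R p)) ⟩
      neg (P′ (R (R p)))        ∎
      where
      open ≅-Reasoning
      P-pincherle-R : P (pincherle R p) ≅ neg (P′ (R p))
      P-pincherle-R = ≅-trans
        (inverseˡ-unique _ _ (≅-trans (≅-sym (pincherle-∘ (applyPS-linear (divD q)) R p))
                                      (≅-trans (pincherle-cong P∘R≅id p) (⊕-inverseʳ (X̂ p)))))
        (neg-cong (pincherle-applyPS (divD q) (R p)))

    pincherle-Rⁿ : ∀ n p → pincherle (powOp n R) p ≅ neg (scale (fromℕ n) (P′ (powOp (suc n) R p)))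
    pincherle-Rⁿ zero    p = ≅-trans (⊕-inverseʳ (X̂ p)) (≅-sym (neg-cong (scale-0 _)))
    pincherle-Rⁿ (suc n) p = begin
      pincherle (R ∘ powOp n R) p
        ≈⟨ pincherle-∘ (applyPS-linear r) (powOp n R) p ⟩
      R (pincherle (powOp n R) p) ⊕ pincherle R (powOp n R p)
        ≈⟨ ⊕-cong (R.cong (pincherle-Rⁿ n p)) (pincherle-R (powOp n R p)) ⟩
      R (neg (scale (fromℕ n) (P′ (powOp (suc n) R p)))) ⊕ neg Z
        ≈⟨ ⊕-congʳ (neg Z) (≅-trans (R.neg-homo (scale (fromℕ n) Z′))
             (neg-cong (≅-trans (R.scale-homo (fromℕ n) Z′)
                                (scale-cong refl (applyPS-comm r (derivPS (divD q)) (powOp (suc n) R p)))))) ⟩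
      neg (scale (fromℕ n) Z) ⊕ neg Z
        ≈⟨ ⁻¹-∙-comm (scale (fromℕ n) Z) Z ⟩
      neg (scale (fromℕ n) Z ⊕ Z)
        ≈⟨ neg-cong (scale-suc n Z) ⟩
      neg (scale (fromℕ (suc n)) Z)
        ∎
      where
      open ≅-Reasoning
      Z′ = P′ (powOp (suc n) R p)
      Z = P′ (powOp (suc (suc n)) R p)

    D-Rⁿ : ∀ n p → D (powOp n R p) ≅ powOp n R (D p)
    D-Rⁿ zero    p = ≅-refl
    D-Rⁿ (suc n) p = ≅-trans (D-applyPS r (powOp n R p)) (R.cong (D-Rⁿ n p))

    transferPoly : ℕ → Pol
    transferPoly n = powOp (suc n) R (monomial n)

    ψ : ℕ → Pol
    ψ zero    = const 1#
    ψ (suc n) = X̂ (transferPoly n)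

    D-P′-transferPoly : ∀ n → D (P′ (transferPoly n)) ≅ P′ (powOp (suc n) R (D (monomial n)))
    D-P′-transferPoly n = ≅-trans (D-applyPS _ (transferPoly n))
                                  (IsLinear.cong (applyPS-linear (derivPS (divD q))) (D-Rⁿ (suc n) (monomial n)))

    pincherle-Q-transferPoly : ∀ n → pincherle Q (transferPoly n) ≅ ψ n
    pincherle-Q-transferPoly zero    =
      ≅-trans (pincherle-Q (transferPoly 0)) (⊕-cong (D-P′-transferPoly 0) (P∘R≅id (monomial 0)))
    pincherle-Q-transferPoly (suc m) = begin
      pincherle Q (transferPoly (suc m))
        ≈⟨ pincherle-Q (transferPoly (suc m)) ⟩
      D (P′ (transferPoly (suc m))) ⊕ P (R (powOp (suc m) R (X̂ (monomial m))))
        ≈⟨ ⊕-cong (≅-trans (D-P′-transferPoly (suc m)) (≅-trans (P′Rⁿ.cong (suc (suc m)) (D-monomial m))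
                                                                (P′Rⁿ.scale-homo (suc (suc m)) _ _)))
                  (≅-trans (P∘R≅id _) (≅-trans (X̂-commutator (powOp (suc m) R) (monomial m))
                                               (⊕-congˡ (ψ (suc m)) (pincherle-Rⁿ (suc m) (monomial m))))) ⟩
      scale (fromℕ (suc m)) Z ⊕ (ψ (suc m) ⊕ neg (scale (fromℕ (suc m)) Z))
        ≈⟨ ⊕-cancel (scale (fromℕ (suc m)) Z) (ψ (suc m)) ⟩
      ψ (suc m)
        ∎
      where
      open ≅-Reasoning
      Z = P′ (powOp (suc (suc m)) R (monomial m))

    Q-transferPoly : ∀ n → Q (transferPoly n) ≅ powOp n R (D (monomial n))
    Q-transferPoly n = ≅-trans (Q≅DP (transferPoly n))
      (≅-trans (IsLinear.cong D-linear (P∘R≅id (powOp n R (monomial n)))) (D-Rⁿ n (monomial n)))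

    Q-ψ : ∀ n → Q (ψ (suc n)) ≅ scale (fromℕ (suc n)) (ψ n)
    Q-ψ zero = begin
      Q (X̂ (transferPoly 0))
        ≈⟨ X̂-commutator Q (transferPoly 0) ⟩
      X̂ (Q (transferPoly 0)) ⊕ pincherle Q (transferPoly 0)
        ≈⟨ ⊕-cong (≅-trans (IsLinear.cong X̂-linear (Q-transferPoly 0)) (IsLinear.[]-homo X̂-linear))
                  (pincherle-Q-transferPoly 0) ⟩
      ψ 0
        ≈⟨ ≅-sym (≅-trans (scale-cong fromℕ-1 ≅-refl) (scale-1 (ψ 0))) ⟩
      scale (fromℕ 1) (ψ 0)
        ∎
      where open ≅-Reasoning
    Q-ψ (suc m) = begin
      Q (X̂ (transferPoly (suc m)))
        ≈⟨ X̂-commutator Q (transferPoly (suc m)) ⟩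
      X̂ (Q (transferPoly (suc m))) ⊕ pincherle Q (transferPoly (suc m))
        ≈⟨ ⊕-cong (IsLinear.cong X̂-linear (≅-trans (Q-transferPoly (suc m))
                    (≅-trans (Rⁿ.cong (suc m) (D-monomial m)) (Rⁿ.scale-homo (suc m) _ _))))
                  (pincherle-Q-transferPoly (suc m)) ⟩
      X̂ (scale (fromℕ (suc m)) (transferPoly m)) ⊕ ψ (suc m)
        ≈⟨ ⊕-congʳ (ψ (suc m)) (IsLinear.scale-homo X̂-linear (fromℕ (suc m)) (transferPoly m)) ⟩
      scale (fromℕ (suc m)) (ψ (suc m)) ⊕ ψ (suc m)
        ≈⟨ scale-suc (suc m) (ψ (suc m)) ⟩
      scale (fromℕ (suc (suc m))) (ψ (suc m))
        ∎
      where open ≅-Reasoning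

    -- Q d = D (P d) = 0 makes P d, hence d = R (P d), constant.
    Q-kernel : ∀ {d} → Q d ≅ [] → coeff d 0 ≈ 0# → d ≅ []
    Q-kernel {d} Qd≅0 d₀≈0 = DegreeBelow-0 (degreeBelow λ where
        zero    _ → d₀≈0
        (suc j) _ → coeff-≥ d-constant (suc j) (s≤s z≤n))
      where
      Pd-constant : DegreeBelow (P d) 1
      Pd-constant = D-kernel (≅-trans (≅-sym (Q≅DP d)) Qd≅0)
      d-constant : DegreeBelow d 1
      d-constant = DegreeBelow-resp (≅-trans (≅-sym (applyPS-partialPS r Pd-constant)) (R∘P≅id d))
                                    (DegreeBelow-scale (r 0) Pd-constant)

    IsBasicSeq⇒≅ψ : ∀ φ → IsBasicSeq q φ → ∀ n → φ n ≅ ψ n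
    IsBasicSeq⇒≅ψ φ (_ , φ₀≋1 , _ , _)            zero    = coeffwise φ₀≋1
    IsBasicSeq⇒≅ψ φ isBasic@(_ , _ , φ[0]≈0 , Qφ≋) (suc m) = x∙y⁻¹≈ε⇒x≈y _ _ (Q-kernel Qd≅0 d₀≈0)
      where
      Qd≅0 : Q (φ (suc m) ⊕ neg (ψ (suc m))) ≅ []
      Qd≅0 = begin
        Q (φ (suc m) ⊕ neg (ψ (suc m)))
          ≈⟨ Q.⊕-homo (φ (suc m)) (neg (ψ (suc m))) ⟩
        Q (φ (suc m)) ⊕ Q (neg (ψ (suc m)))
          ≈⟨ ⊕-cong (coeffwise {Q (φ (suc m))} {scale (fromℕ (suc m)) (φ m)} (Qφ≋ m))
                    (≅-trans (Q.neg-homo (ψ (suc m))) (neg-cong (Q-ψ m))) ⟩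
        scale (fromℕ (suc m)) (φ m) ⊕ neg (scale (fromℕ (suc m)) (ψ m))
          ≈⟨ ⊕-congʳ (neg (scale (fromℕ (suc m)) (ψ m))) (scale-cong refl (IsBasicSeq⇒≅ψ φ isBasic m)) ⟩
        scale (fromℕ (suc m)) (ψ m) ⊕ neg (scale (fromℕ (suc m)) (ψ m))
          ≈⟨ ⊕-inverseʳ (scale (fromℕ (suc m)) (ψ m)) ⟩
        []
          ∎
        where open ≅-Reasoning
      d₀≈0 : coeff (φ (suc m) ⊕ neg (ψ (suc m))) 0 ≈ 0#
      d₀≈0 = trans (coeff-⊕ (φ (suc m)) _ 0)
        (trans (+-cong (φ[0]≈0 m) (coeff-neg (ψ (suc m)) 0)) (trans (+-identityˡ _) -0#≈0#))

mainTheorem8 : ∀ {c ℓ : Level} (F : Field0 c ℓ) → let open Poly F in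
    (q : PS) → IsDelta q → (r : PS) → IsDoverQ q r → (φ : ℕ → Pol) → IsBasicSeq q φ →
      (∀ p → linExt φ p ≋ pincherle (applyPS q) (expXD1 r p))
      × (∀ n → φ (suc n) ≋ X̂ (expXD1 r (monomial n)))
mainTheorem8 F q isDelta r r-inverse φ isBasic = coeff-≈ ∘ firstTransfer , coeff-≈ ∘ secondTransfer
  where
  open Umbral F
  open Poly F
  open Transfer q (IsDelta-constantTerm {q} isDelta) r r-inverse

  Q′-linear : IsLinear (pincherle Q)
  Q′-linear = pincherle-linear (applyPS-linear q)

  firstTransfer : ∀ p → linExt φ p ≅ pincherle Q (expXD1 r p)
  firstTransfer p = begin
    linExt φ p
      ≈⟨ linExt-cong< p (λ i _ → ≅-trans (IsBasicSeq⇒≅ψ φ isBasic i) (≅-sym (pincherle-Q-transferPoly i))) ⟩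
    linExt (pincherle Q ∘ transferPoly) p
      ≈⟨ ≅-sym (IsLinear.linExt-homo Q′-linear transferPoly p) ⟩
    pincherle Q (linExt transferPoly p)
      ≈⟨ IsLinear.cong Q′-linear (≅-sym (expXD1-linExt r p)) ⟩
    pincherle Q (expXD1 r p)
      ∎
    where open ≅-Reasoning

  secondTransfer : ∀ n → φ (suc n) ≅ X̂ (expXD1 r (monomial n))
  secondTransfer n =
    ≅-trans (IsBasicSeq⇒≅ψ φ isBasic (suc n)) (IsLinear.cong X̂-linear (≅-sym (expXD1-monomial r n)))
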